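{- If $n\geq 7$, then $\widehat{K}_n\notin\mathfrak{N}$, where $K_n$ is the complete graph on $n$ vertices.
   Context: All graphs are finite, without loops or multiple edges. An interval $t$-coloring of a graph $H$ is a proper edge-coloring of $H$ with colors $1,\ldots,t$ such that every color is used and for every vertex $v$ the set of colors of edges incident to $v$ is an interval of integers. $\mathfrak{N}$ denotes the set of graphs having an interval $t$-coloring for some positive integer $t$. For a graph $G$, $\widehat{G}$ is the graph obtained by subdividing every edge $v_iv_j$ of $G$ with a new vertex $w_{ij}$ (replacing $v_iv_j$ by $v_iw_{ij},v_jw_{ij}$) and then adding a new vertex $u$ adjacent to all the subdivision vertices $w_{ij}$. -}

module Defs where

open import Data.Nat using (ℕ; _≤_; _<ᵇ_)
open import Data.Fin using (Fin; toℕ; _≟_)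
open import Data.Bool using (Bool; true; false; T; _∧_; not)
open import Data.Product using (Σ; ∃-syntax; _×_; _,_)
open import Relation.Binary.PropositionalEquality using (_≡_)
open import Relation.Nullary.Decidable using (⌊_⌋)

record Graph : Set₁ where
  field
    Vtx   : Set
    adj   : Vtx → Vtx → Bool
    sym   : ∀ x y → adj x y ≡ adj y x
    irref : ∀ x → adj x x ≡ false

open Graph public

-- An edge colouring is given on adjacent ordered pairs (required symmetric).
Colouring : Graph → Set
Colouring G = (x y : Vtx G) → T (adj G x y) → ℕ

AtVertex : (G : Graph) → Colouring G → Vtx G → ℕ → Set
AtVertex G c x k = ∃[ y ] Σ (T (adj G x y)) λ e → c x y e ≡ k

record IntervalColouring (G : Graph) (t : ℕ) : Set where
  field
    col      : Colouring G
    symm     : ∀ x y (e : T (adj G x y)) (e' : T (adj G y x)) → col x y e ≡ col y x e'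
    range    : ∀ x y (e : T (adj G x y)) → 1 ≤ col x y e × col x y e ≤ t
    proper   : ∀ x y z (e : T (adj G x y)) (f : T (adj G x z)) →
               col x y e ≡ col x z f → y ≡ z
    surj     : ∀ k → 1 ≤ k → k ≤ t → ∃[ x ] AtVertex G col x k
    interval : ∀ x a b k → AtVertex G col x a → AtVertex G col x b →
               a ≤ k → k ≤ b → AtVertex G col x k

-- 𝔑: graphs having an interval t-colouring for some positive integer t.
IntervalColourable : Graph → Set
IntervalColourable G = ∃[ t ] (1 ≤ t × IntervalColouring G t)

-- K̂_n. Vertices: the originals v_i (i ∈ Fin n), one subdivision vertex
-- w_ij for each edge v_iv_j of K_n (i.e. each pair i < j), and the apex u.
data HatKV (n : ℕ) : Set where
  v : Fin n → HatKV n
  w : (i j : Fin n) → .(T (toℕ i <ᵇ toℕ j)) → HatKV n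
  u : HatKV n

eqᵇ : ∀ {n} → Fin n → Fin n → Bool
eqᵇ a b = ⌊ a ≟ b ⌋

hatKAdj : ∀ {n} → HatKV n → HatKV n → Bool
hatKAdj (v a)     (w i j _) = eqᵇ a i Data.Bool.∨ eqᵇ a j
hatKAdj (w i j _) (v a)     = eqᵇ a i Data.Bool.∨ eqᵇ a j
hatKAdj (w _ _ _) u         = true
hatKAdj u         (w _ _ _) = true
hatKAdj _         _         = false

hatKAdj-sym : ∀ {n} (x y : HatKV n) → hatKAdj x y ≡ hatKAdj y x
hatKAdj-sym (v _) (v _) = Relation.Binary.PropositionalEquality.refl
hatKAdj-sym (v _) (w _ _ _) = Relation.Binary.PropositionalEquality.refl
hatKAdj-sym (v _) u = Relation.Binary.PropositionalEquality.refl
hatKAdj-sym (w _ _ _) (v _) = Relation.Binary.PropositionalEquality.refl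
hatKAdj-sym (w _ _ _) (w _ _ _) = Relation.Binary.PropositionalEquality.refl
hatKAdj-sym (w _ _ _) u = Relation.Binary.PropositionalEquality.refl
hatKAdj-sym u (v _) = Relation.Binary.PropositionalEquality.refl
hatKAdj-sym u (w _ _ _) = Relation.Binary.PropositionalEquality.refl
hatKAdj-sym u u = Relation.Binary.PropositionalEquality.refl

hatKAdj-irref : ∀ {n} (x : HatKV n) → hatKAdj x x ≡ false
hatKAdj-irref (v _) = Relation.Binary.PropositionalEquality.refl
hatKAdj-irref (w _ _ _) = Relation.Binary.PropositionalEquality.refl
hatKAdj-irref u = Relation.Binary.PropositionalEquality.refl

hatK : ℕ → Graph
hatK n = record { Vtx = HatKV n ; adj = hatKAdj ; sym = hatKAdj-sym ; irref = hatKAdj-irref }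

module Submission where

-- In an interval colouring, a vertex x whose neighbours all lie in a list L
-- carries colours spanning at most |L| - 1: the colours between any two
-- colours at x all occur at x, on pairwise distinct edges.  In K̂_n every
-- subdivision vertex w_ij has degree 3 and every v_a has at most n neighbours,
-- so walking  u - w_p - v_a - w_r - v_c - w_q - u  through suitable vertices
-- shows that any two colours at the apex u differ by at most
-- 2 + (n-1) + 2 + (n-1) + 2.  The C(n,2) edges at u carry pairwise distinct
-- colours, and distinct naturals with that small a spread are few, which
-- forces C(n,2) ≤ 2n + 5; this fails for n ≥ 7.
-- The file proves, in order: counting facts about lists of naturals, the
-- degree/spread lemma for arbitrary interval colourings, the combinatorics of
-- K̂_n (the edge list of K_n and the neighbourhoods of v_a and w_ij), the
-- spread bound at u, and finally the theorem.

open import Defs hiding (sym)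
open import Data.Nat using (ℕ; zero; suc; _+_; _∸_; _≤_; _<_; _<ᵇ_; z≤n; s≤s; s≤s⁻¹)
open import Data.Nat.Properties
open import Data.Nat.Tactic.RingSolver using (solve-∀)
open import Data.Fin as Fin using (Fin; toℕ; fromℕ<)
open import Data.Fin.Properties using (toℕ-injective; toℕ-fromℕ<; injective⇒≤)
import Data.Fin.Properties as FinP
open import Data.Bool using (T)
open import Data.Bool.Properties using (T-irrelevant; T-∨)
open import Data.Unit using (tt)
open import Data.Empty using (⊥-elim)
open import Data.Product using (Σ; _×_; _,_; proj₁; proj₂)
open import Data.Sum using (_⊎_; inj₁; inj₂)
open import Data.List using (List; []; _∷_; length; map; _++_; lookup; allFin)
open import Data.List.Properties using (length-map; length-++; length-tabulate)
open import Data.List.Relation.Unary.Any as Any using (here; there)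
open import Data.List.Relation.Unary.Any.Properties using (lookup-index)
open import Data.List.Relation.Unary.All as All using (All; _∷_)
open import Data.List.Relation.Unary.AllPairs using ([]; _∷_)
open import Data.List.Relation.Unary.Unique.Propositional using (Unique)
import Data.List.Relation.Unary.Unique.Propositional.Properties as Unique
open import Data.List.Membership.Propositional using (_∈_)
open import Data.List.Membership.Propositional.Properties
  using (∈-map⁺; ∈-map⁻; ∈-lookup; ∈-allFin)
open import Data.List.Extrema ≤-totalOrder using (min; min≤⊤; min≤xs; argmin-all)
open import Relation.Binary.PropositionalEquality
  using (_≡_; refl; sym; trans; cong; cong₂; subst; module ≡-Reasoning)
open import Relation.Binary.Definitions using (tri<; tri≈; tri>)
open import Relation.Nullary using (¬_; yes; no)
open import Relation.Nullary.Decidable using (toWitness; fromWitness; T?; recompute)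
open import Function using (Injective)
open import Function.Bundles using (Equivalence)

-- Counting distinct naturals

unique-lookup-injective : ∀ {A : Set} {xs : List A} → Unique xs →
                          ∀ i j → lookup xs i ≡ lookup xs j → i ≡ j
unique-lookup-injective (_ ∷ _) Fin.zero Fin.zero _ = refl
unique-lookup-injective (x∉ ∷ _) Fin.zero (Fin.suc j) eq =
  ⊥-elim (All.lookup x∉ (∈-lookup j) eq)
unique-lookup-injective (x∉ ∷ _) (Fin.suc i) Fin.zero eq =
  ⊥-elim (All.lookup x∉ (∈-lookup i) (sym eq))
unique-lookup-injective (_ ∷ uniq) (Fin.suc i) (Fin.suc j) eq =
  cong Fin.suc (unique-lookup-injective uniq i j eq)

window-count : ∀ {lo D} (ks : List ℕ) → Unique ks →
               (∀ {a} → a ∈ ks → lo ≤ a × a ≤ lo + D) → length ks ≤ suc D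
window-count {lo} {D} ks uniq window = injective⇒≤ offset-injective
  where
    offset : Fin (length ks) → Fin (suc D)
    offset i = fromℕ< (s≤s (m≤n+o⇒m∸n≤o (lookup ks i) lo (proj₂ (window (∈-lookup i)))))

    offset-injective : Injective _≡_ _≡_ offset
    offset-injective {i} {j} eq =
      unique-lookup-injective uniq i j
        (∸-cancelʳ-≡ (proj₁ (window (∈-lookup i))) (proj₁ (window (∈-lookup j)))
          (trans (sym (toℕ-fromℕ< _)) (trans (cong toℕ eq) (toℕ-fromℕ< _))))

-- Distinct naturals any two of which differ by at most D number at most
-- D + 1: they all lie in the window starting at their minimum.
spread-count : ∀ {D} (ks : List ℕ) → Unique ks →
               (∀ {a b} → a ∈ ks → b ∈ ks → a ≤ b + D) → length ks ≤ suc D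
spread-count []       _    _      = z≤n
spread-count {D} (k ∷ ks) uniq spread = window-count (k ∷ ks) uniq in-window
  where
    lo = min k ks

    lo-lower : All (lo ≤_) (k ∷ ks)
    lo-lower = min≤⊤ k ks ∷ min≤xs k ks

    in-window : ∀ {a} → a ∈ k ∷ ks → lo ≤ a × a ≤ lo + D
    in-window a∈ = All.lookup lo-lower a∈
                 , argmin-all (λ b → b) (spread a∈ (here refl))
                     (All.tabulate (λ b∈ → spread a∈ (there b∈)))

-- Interval colourings of an arbitrary graph

module IntervalFacts {G : Graph} {t : ℕ} (IC : IntervalColouring G t) where
  open IntervalColouring IC

  col-cong : ∀ x {y y'} (e : T (adj G x y)) (e' : T (adj G x y')) → y ≡ y' →
             col x y e ≡ col x y' e'
  col-cong x e e' refl = cong (col x _) (T-irrelevant e e')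

  at-source : ∀ x y (e : T (adj G x y)) → AtVertex G col x (col x y e)
  at-source x y e = y , e , refl

  at-target : ∀ x y (e : T (adj G x y)) → AtVertex G col y (col x y e)
  at-target x y e = x , e' , sym (symm x y e e')
    where e' = subst T (Graph.sym G x y) e

  module _ (x : Vtx G) (L : List (Vtx G)) (covers : ∀ y → T (adj G x y) → y ∈ L) where

    -- If β ≤ α are colours at x, the α - β + 1 colours β,…,α occur at x
    -- (interval property) on distinct edges (properness), hence at distinct
    -- members of L.
    colour-range : ∀ {α β} → β ≤ α → AtVertex G col x α → AtVertex G col x β →
                   suc (α ∸ β) ≤ length L
    colour-range {α} {β} β≤α atα atβ = injective⇒≤ neighbour-injective
      where
        occurs : (k : Fin (suc (α ∸ β))) → AtVertex G col x (β + toℕ k)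
        occurs k = interval x β α (β + toℕ k) atβ atα (m≤m+n β (toℕ k))
                     (≤-trans (+-monoʳ-≤ β (s≤s⁻¹ (FinP.toℕ<n k)))
                              (≤-reflexive (m+[n∸m]≡n β≤α)))

        neighbour : Fin (suc (α ∸ β)) → Fin (length L)
        neighbour k = Any.index (covers (proj₁ (occurs k)) (proj₁ (proj₂ (occurs k))))

        neighbour-injective : Injective _≡_ _≡_ neighbour
        neighbour-injective {i} {j} eq = toℕ-injective (+-cancelˡ-≡ β _ _ (begin
            β + toℕ i  ≡⟨ sym (proj₂ (proj₂ (occurs i))) ⟩
            col x _ _  ≡⟨ col-cong x _ _ same-neighbour ⟩
            col x _ _  ≡⟨ proj₂ (proj₂ (occurs j)) ⟩
            β + toℕ j  ∎))
          where
            open ≡-Reasoning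
            same-neighbour : proj₁ (occurs i) ≡ proj₁ (occurs j)
            same-neighbour = trans (lookup-index (covers _ _))
                               (trans (cong (lookup L) eq) (sym (lookup-index (covers _ _))))

    spread-at : ∀ {k} → length L ≤ suc k →
                ∀ {α β} → AtVertex G col x α → AtVertex G col x β → α ≤ β + k
    spread-at {k} |L|≤ {α} {β} atα atβ with ≤-total α β
    ... | inj₁ α≤β = ≤-trans α≤β (m≤m+n β k)
    ... | inj₂ β≤α = ≤-trans (m≤n+m∸n α β)
                       (+-monoʳ-≤ β (s≤s⁻¹ (≤-trans (colour-range β≤α atα atβ) |L|≤)))

-- The edges of K_n and the neighbourhoods in K̂_n

record Edge (n : ℕ) : Set where
  constructor edge
  field
    i j : Fin n
    .lt : T (toℕ i <ᵇ toℕ j)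

hub : ∀ {n} → Edge n → HatKV n
hub (edge i j lt) = w i j lt

hub-injective : ∀ {n} {p q : Edge n} → hub p ≡ hub q → p ≡ q
hub-injective {p = edge i j _} {edge .i .j _} refl = refl

Endpoint : ∀ {n} → Fin n → Edge n → Set
Endpoint a (edge i j _) = a ≡ i ⊎ a ≡ j

from-zero : ∀ {n} → Fin n → Edge (suc n)
from-zero j = edge Fin.zero (Fin.suc j) tt

shift : ∀ {n} → Edge n → Edge (suc n)
shift (edge i j lt) = edge (Fin.suc i) (Fin.suc j) lt

edges : ∀ n → List (Edge n)
edges zero    = []
edges (suc n) = map from-zero (allFin n) ++ map shift (edges n)

-- The list has no repetitions, and it has C(n,2) entries by the recursion
-- C(n+1,2) = n + C(n,2).
edges-unique : ∀ n → Unique (edges n)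
edges-unique zero    = []
edges-unique (suc n) =
  Unique.++⁺ (Unique.map⁺ from-zero-injective (Unique.allFin⁺ n))
             (Unique.map⁺ shift-injective (edges-unique n))
             disjoint
  where
    from-zero-injective : ∀ {x y : Fin n} → from-zero x ≡ from-zero y → x ≡ y
    from-zero-injective refl = refl

    shift-injective : ∀ {p q : Edge n} → shift p ≡ shift q → p ≡ q
    shift-injective {edge i j _} {edge .i .j _} refl = refl

    -- shifted edges never contain the vertex 0
    disjoint : ∀ {p} → ¬ (p ∈ map from-zero (allFin n) × p ∈ map shift (edges n))
    disjoint (p∈₁ , p∈₂) with ∈-map⁻ from-zero p∈₁ | ∈-map⁻ shift p∈₂
    ... | _ , _ , refl | edge _ _ _ , _ , ()

edges-length : ∀ n → length (edges (suc n)) ≡ n + length (edges n)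
edges-length n = trans (length-++ (map from-zero (allFin n)))
  (cong₂ _+_ (trans (length-map from-zero (allFin n)) (length-tabulate (λ j → j)))
             (length-map shift (edges n)))

hub-adj : ∀ {n} (p : Edge n) {a} → Endpoint a p → T (hatKAdj (hub p) (v a))
hub-adj (edge i j _) {a} (inj₁ refl) =
  Equivalence.from (T-∨ {x = eqᵇ a i}) (inj₁ (fromWitness {a? = a FinP.≟ i} refl))
hub-adj (edge i j _) {a} (inj₂ refl) =
  Equivalence.from (T-∨ {x = eqᵇ a i}) (inj₂ (fromWitness {a? = a FinP.≟ j} refl))

hub-neighbours : ∀ {n} (p : Edge n) (y : HatKV n) → T (hatKAdj (hub p) y) →
                 y ∈ (v (Edge.i p) ∷ v (Edge.j p) ∷ u ∷ [])
hub-neighbours (edge i j _) (v a) adj with Equivalence.to T-∨ adj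
... | inj₁ a≡i = here (cong v (toWitness {a? = a FinP.≟ i} a≡i))
... | inj₂ a≡j = there (here (cong v (toWitness {a? = a FinP.≟ j} a≡j)))
hub-neighbours (edge i j _) u _ = there (there (here refl))

-- The subdivision vertex between v_a and v_b (and u when a = b).
between : ∀ {n} → Fin n → Fin n → HatKV n
between a b with T? (toℕ a <ᵇ toℕ b)
... | yes a<b = w a b a<b
... | no _ with T? (toℕ b <ᵇ toℕ a)
...   | yes b<a = w b a b<a
...   | no _    = u

between-< : ∀ {n} (a b : Fin n) .(a<b : T (toℕ a <ᵇ toℕ b)) → between a b ≡ w a b a<b
between-< a b a<b with T? (toℕ a <ᵇ toℕ b)
... | yes _ = refl
... | no a≮b = ⊥-elim (a≮b (recompute (T? _) a<b))

between-> : ∀ {n} (a b : Fin n) .(a<b : T (toℕ a <ᵇ toℕ b)) → between b a ≡ w a b a<b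
between-> a b a<b with T? (toℕ b <ᵇ toℕ a)
... | yes b<a = ⊥-elim (<-asym (<ᵇ⇒< (toℕ a) (toℕ b) (recompute (T? _) a<b))
                               (<ᵇ⇒< (toℕ b) (toℕ a) b<a))
... | no _ with T? (toℕ a <ᵇ toℕ b)
...   | yes _ = refl
...   | no a≮b = ⊥-elim (a≮b (recompute (T? _) a<b))

-- Every neighbour of v_a has the form between a b, so v_a has at most n
-- neighbours.
v-neighbours : ∀ {n} (a : Fin n) (y : HatKV n) → T (hatKAdj (v a) y) →
               y ∈ map (between a) (allFin n)
v-neighbours a (w i j i<j) adj with Equivalence.to T-∨ adj
... | inj₁ a≡i with toWitness {a? = a FinP.≟ i} a≡i
...   | refl = subst (_∈ map (between a) (allFin _)) (between-< a j i<j)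
                 (∈-map⁺ (between a) (∈-allFin j))
v-neighbours a (w i j i<j) adj | inj₂ a≡j with toWitness {a? = a FinP.≟ j} a≡j
...   | refl = subst (_∈ map (between a) (allFin _)) (between-> i a i<j)
                 (∈-map⁺ (between a) (∈-allFin i))

-- For an edge p with endpoint a, and any c, some edge contains both a and c
-- (p itself when c = a).
joining-edge : ∀ {n} {a} (p : Edge n) → Endpoint a p → (c : Fin n) →
               Σ (Edge n) λ r → Endpoint a r × Endpoint c r
joining-edge {a = a} p a∈p c with FinP.<-cmp a c
... | tri< a<c _ _    = edge a c (<⇒<ᵇ a<c) , inj₁ refl , inj₂ refl
... | tri≈ _ refl _   = p , a∈p , a∈p
... | tri> _ _ c<a    = edge c a (<⇒<ᵇ c<a) , inj₂ refl , inj₁ refl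

-- The colours at the apex u

-- Bound on the spread of the colours at u in K̂_{m+1}: three subdivision
-- vertices (spread ≤ 2 each) and two original vertices (spread ≤ m each).
apex-spread : ℕ → ℕ
apex-spread m = 2 + m + 2 + m + 2

regroup : ∀ x m → x + 2 + m + 2 + m + 2 ≡ x + (2 + m + 2 + m + 2)
regroup = solve-∀

apex-spread-suc : ∀ m → suc (2 + suc m + 2 + suc m + 2) ≡ 2 + suc (2 + m + 2 + m + 2)
apex-spread-suc = solve-∀

module Apex {m t : ℕ} (IC : IntervalColouring (hatK (suc m)) t) where
  open IntervalColouring IC
  open IntervalFacts IC

  apex-colour : Edge (suc m) → ℕ
  apex-colour p = col u (hub p) tt

  side-colour : (p : Edge (suc m)) (a : Fin (suc m)) → Endpoint a p → ℕ
  side-colour p a a∈p = col (hub p) (v a) (hub-adj p a∈p)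

  -- w_p has three neighbours and v_a at most m + 1, which bounds the
  -- spread of their colours.
  hub-spread : ∀ p {α β} → AtVertex (hatK (suc m)) col (hub p) α →
               AtVertex (hatK (suc m)) col (hub p) β → α ≤ β + 2
  hub-spread p = spread-at (hub p) _ (hub-neighbours p) ≤-refl

  v-spread : ∀ a {α β} → AtVertex (hatK (suc m)) col (v a) α →
             AtVertex (hatK (suc m)) col (v a) β → α ≤ β + m
  v-spread a = spread-at (v a) _ (v-neighbours a)
                 (≤-reflexive (trans (length-map (between a) (allFin _)) (length-tabulate (λ b → b))))

  -- Follow the path  u - w_p - v_a - w_r - v_c - w_q - u.
  apex-path : ∀ p r q {a c} (a∈p : Endpoint a p) (a∈r : Endpoint a r)
              (c∈r : Endpoint c r) (c∈q : Endpoint c q) →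
              apex-colour p ≤ apex-colour q + apex-spread m
  apex-path p r q {a} {c} a∈p a∈r c∈r c∈q = begin
    apex-colour p
      ≤⟨ hub-spread p (at-target u (hub p) tt) (at-source (hub p) (v a) (hub-adj p a∈p)) ⟩
    side-colour p a a∈p + 2
      ≤⟨ +-monoˡ-≤ 2 (v-spread a (at-target (hub p) (v a) _) (at-target (hub r) (v a) _)) ⟩
    side-colour r a a∈r + m + 2
      ≤⟨ +-monoˡ-≤ 2 (+-monoˡ-≤ m
           (hub-spread r (at-source (hub r) (v a) _) (at-source (hub r) (v c) (hub-adj r c∈r)))) ⟩
    side-colour r c c∈r + 2 + m + 2
      ≤⟨ +-monoˡ-≤ 2 (+-monoˡ-≤ m (+-monoˡ-≤ 2
           (v-spread c (at-target (hub r) (v c) _) (at-target (hub q) (v c) (hub-adj q c∈q))))) ⟩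
    side-colour q c c∈q + m + 2 + m + 2
      ≤⟨ +-monoˡ-≤ 2 (+-monoˡ-≤ m (+-monoˡ-≤ 2 (+-monoˡ-≤ m
           (hub-spread q (at-source (hub q) (v c) _) (at-target u (hub q) tt))))) ⟩
    apex-colour q + 2 + m + 2 + m + 2
      ≡⟨ regroup (apex-colour q) m ⟩
    apex-colour q + apex-spread m ∎
    where open ≤-Reasoning

  -- Any two colours at u are close: join the edges p = {a,_} and q = {c,_}
  -- through an edge r containing a and c.
  apex-colours-close : ∀ p q → apex-colour p ≤ apex-colour q + apex-spread m
  apex-colours-close p@(edge a _ _) q@(edge c _ _) =
    let (r , a∈r , c∈r) = joining-edge p (inj₁ refl) c
    in apex-path p r q (inj₁ refl) a∈r c∈r (inj₁ refl)

  apex-colour-injective : ∀ {p q} → apex-colour p ≡ apex-colour q → p ≡ q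
  apex-colour-injective eq = hub-injective (proper u (hub _) (hub _) tt tt eq)

  few-edges : length (edges (suc m)) ≤ suc (apex-spread m)
  few-edges = subst (_≤ suc (apex-spread m)) (length-map apex-colour (edges (suc m)))
    (spread-count (map apex-colour (edges (suc m)))
      (Unique.map⁺ apex-colour-injective (edges-unique (suc m)))
      close)
    where
      close : ∀ {α β} → α ∈ map apex-colour (edges (suc m)) →
              β ∈ map apex-colour (edges (suc m)) → α ≤ β + apex-spread m
      close α∈ β∈ with ∈-map⁻ apex-colour α∈ | ∈-map⁻ apex-colour β∈
      ... | p , _ , refl | q , _ , refl = apex-colours-close p q

-- For n ≥ 7, K_n has more edges than the apex bound allows: C(7,2) = 21 > 19,
-- and each further vertex adds n ≥ 2 edges while the bound grows by 2.
many-edges : ∀ k → suc (apex-spread (6 + k)) < length (edges (7 + k))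
many-edges zero    = n≤1+n 20
many-edges (suc k) = begin-strict
  suc (apex-spread (7 + k))              ≡⟨ apex-spread-suc (6 + k) ⟩
  2 + suc (apex-spread (6 + k))          <⟨ +-monoʳ-< 2 (many-edges k) ⟩
  2 + length (edges (7 + k))             ≤⟨ +-monoˡ-≤ (length (edges (7 + k))) (s≤s (s≤s (z≤n {5 + k}))) ⟩
  (7 + k) + length (edges (7 + k))       ≡⟨ sym (edges-length (7 + k)) ⟩
  length (edges (8 + k))                 ∎
  where open ≤-Reasoning

corollary3 : (n : ℕ) → 7 ≤ n → ¬ IntervalColourable (hatK n)
corollary3 n 7≤n (t , _ , IC) with m≤n⇒∃[o]m+o≡n 7≤n
... | k , refl = <⇒≱ (many-edges k) (Apex.few-edges IC)
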